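{- Let $\mathcal F\subseteq 2^{[n]}$ be a simply rooted family of sets such that $\emptyset\in\mathcal F$, and let $A\in\mathcal F$ be non-empty. For $k\ge 0$ let $\mathcal C_k(\mathcal F,A)=\{[C,A]: C\subseteq A,\ [C,A]\subseteq\mathcal F,\ |A\setminus C|=k\}$. Then $$\sum_{k=0}^{|A|}(-1)^k|\mathcal C_k(\mathcal F,A)|=0.$$
   Context: $[n]=\{1,\dots,n\}$, $2^{[n]}$ its power set. For $A,B\in 2^{[n]}$, $[A,B]=\{C\in 2^{[n]}: A\subseteq C\subseteq B\}$ and $[i,B]$ means $[\{i\},B]$. A family $\mathcal F\subseteq 2^{[n]}$ is simply rooted if for every non-empty $A\in\mathcal F$ there is $i\in A$ with $[i,A]\subseteq\mathcal F$. -}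

module Defs where

open import Data.Nat using (ℕ; zero; suc; _≡ᵇ_)
open import Data.Bool using (Bool; true; false; _∧_; _∨_; not)
open import Data.List using (List; []; _∷_; _++_; map; filterᵇ; length)
open import Data.Bool.ListAction using (and)
open import Data.Vec using (_∷_; [])
open import Data.Fin using (Fin)
open import Data.Fin.Subset using (Subset; inside; outside; _⊆_; _∈_; ⁅_⁆; _─_; ∣_∣; Nonempty)
open import Data.Fin.Subset.Properties using (_⊆?_)
open import Data.Product using (∃; _×_)
open import Data.Integer using (ℤ; +_; -_; _*_; _+_; 0ℤ; 1ℤ)
open import Relation.Nullary using (Dec; does)
open import Relation.Unary using (Pred; Decidable)
open import Level using (0ℓ)

IntervalIn : ∀ {n} → Pred (Subset n) 0ℓ → Subset n → Subset n → Set
IntervalIn 𝓕 C A = ∀ D → C ⊆ D → D ⊆ A → 𝓕 D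

SimplyRooted : ∀ {n} → Pred (Subset n) 0ℓ → Set
SimplyRooted {n} 𝓕 =
  ∀ (A : Subset n) → 𝓕 A → Nonempty A → ∃ λ (i : Fin n) → i ∈ A × IntervalIn 𝓕 ⁅ i ⁆ A

allSubsets : ∀ n → List (Subset n)
allSubsets zero = [] ∷ []
allSubsets (suc n) = map (outside ∷_) (allSubsets n) ++ map (inside ∷_) (allSubsets n)

intervalInᵇ : ∀ {n} {𝓕 : Pred (Subset n) 0ℓ} → Decidable 𝓕 → Subset n → Subset n → Bool
intervalInᵇ {n} 𝓕? C A =
  and (map (λ D → not (does (C ⊆? D) ∧ does (D ⊆? A)) ∨ does (𝓕? D)) (allSubsets n))

-- |𝓒_k(𝓕, A)| : number of intervals [C, A] with C ⊆ A, [C, A] ⊆ 𝓕, |A ∖ C| = k.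
-- Since C ⊆ A, the interval [C, A] determines C (its least element), so we count the C's.
countC : ∀ {n} {𝓕 : Pred (Subset n) 0ℓ} → Decidable 𝓕 → Subset n → ℕ → ℕ
countC {n} 𝓕? A k =
  length (filterᵇ (λ C → does (C ⊆? A) ∧ intervalInᵇ 𝓕? C A ∧ (∣ A ─ C ∣ ≡ᵇ k))
                  (allSubsets n))

sign : ℕ → ℤ
sign zero = 1ℤ
sign (suc k) = - sign k

altSum : ℕ → (ℕ → ℕ) → ℤ
altSum zero f = + f 0
altSum (suc m) f = altSum m f + sign (suc m) * + f (suc m)

-- Write f(A) for the signed count of the C ⊆ A with [C, A] ⊆ 𝓕, each weighted by (-1)^|A ∖ C|,
-- and b(B) = Σ_{C ⊆ B} (-1)^|B ∖ C|, which vanishes for B ≠ ∅. Let i be a root of A and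
-- A′ = A ∖ {i}, and pair each C ∌ i with C ∪ {i}. Every [C ∪ {i}, A] lies in [i, A] ⊆ 𝓕, while
-- [C, A] ⊆ 𝓕 iff [C, A′] ⊆ 𝓕 and |A ∖ C| = |A′ ∖ C| + 1; hence f(A) = b(A′) − f(A′).
-- Induction on |A| then gives f = b everywhere (for B ∉ 𝓕 both sides vanish, as ∅ ∈ 𝓕 forces
-- B ≠ ∅), so f(A) = b(A) = 0 for non-empty A.

{-# OPTIONS --safe #-}
module Submission where

open import Defs
open import Data.Nat using (ℕ)
open import Data.Fin.Subset using (Subset; ⊥; ∣_∣; Nonempty)
open import Relation.Unary using (Pred; Decidable)
open import Relation.Binary.PropositionalEquality using (_≡_)
open import Data.Integer using (0ℤ)
open import Level using (0ℓ)

open import Data.Nat as ℕ using (zero; suc; _≤_; _<_; z≤n; s≤s; _≡ᵇ_; _≟_)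
open import Data.Nat.Properties using (≤-refl; m≤n⇒m≤1+n; m≤n⇒m<n∨m≡n; <⇒≢; >⇒≢; <-≤-trans; n<1+n)
open import Data.Integer using (ℤ; +_; -_; _+_; _-_; _*_; 1ℤ)
open import Data.Integer.Properties
  using (+-comm; +-assoc; +-identityˡ; +-identityʳ; +-inverseˡ; +-inverseʳ; *-zeroʳ; *-identityʳ;
         *-distribˡ-+; pos-+; neg-distrib-+; +-commutativeSemigroup)
open import Algebra.Properties.CommutativeSemigroup +-commutativeSemigroup using (interchange)
open import Data.Bool using (Bool; true; false; _∧_; _∨_; not; if_then_else_; T)
open import Data.Bool.Properties using (∧-assoc; ∧-identityʳ; T-≡)
open import Data.List using (List; []; _∷_; _++_; map; filterᵇ; length)
import Data.List.Membership.Propositional as List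
open import Data.List.Membership.Propositional.Properties using (∈-++⁺ˡ; ∈-++⁺ʳ; ∈-map⁺)
import Data.List.Relation.Unary.All as All
import Data.List.Relation.Unary.Any as Any
open import Data.List.Relation.Unary.All.Properties using (all⁺; all⁻)
open import Data.Vec using (_∷_; []; lookup; _[_]≔_; here; there)
open import Data.Vec.Properties using ([]=⇒lookup; lookup⇒[]=; lookup∘update; []≔-updates)
open import Data.Fin using (Fin; zero; suc)
open import Data.Fin.Subset using (inside; outside; _⊆_; _∈_; ⁅_⁆; _─_)
open import Data.Fin.Subset.Properties
  using (_⊆?_; nonempty?; Empty-unique; ⊆-refl; ⊆-trans; ⊆-antisym; ⊆-min; ∣p─q∣≤∣p∣; x∈⁅y⁆⇒x≡y;
         out⊆; in⊆in; drop-∷-⊆)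
open import Data.Product using (_,_)
open import Data.Sum using (inj₁; inj₂)
open import Function using (_⇔_; mk⇔; Equivalence)
import Function.Properties.Equivalence as ⇔
open import Relation.Nullary using (Dec; yes; no; does; ¬_; contradiction)
open import Relation.Nullary.Decidable using (T?; dec-true; dec-false; does-⇔)
open import Relation.Binary.PropositionalEquality
  using (refl; sym; trans; cong; cong₂; subst; module ≡-Reasoning)

open ≡-Reasoning

𝟙 : Bool → ℕ
𝟙 b = if b then 1 else 0

signIf : Bool → ℕ → ℤ
signIf b k = if b then sign k else 0ℤ

signIf-suc : ∀ b k → signIf b (suc k) ≡ - signIf b k
signIf-suc true  k = refl
signIf-suc false k = refl

altSum-cong : ∀ m {f g : ℕ → ℕ} → (∀ k → f k ≡ g k) → altSum m f ≡ altSum m g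
altSum-cong zero    f≗g = cong +_ (f≗g 0)
altSum-cong (suc m) f≗g =
  cong₂ _+_ (altSum-cong m f≗g) (cong (λ x → sign (suc m) * + x) (f≗g (suc m)))

altSum-+ : ∀ m (f g : ℕ → ℕ) → altSum m (λ k → f k ℕ.+ g k) ≡ altSum m f + altSum m g
altSum-+ zero    f g = pos-+ (f 0) (g 0)
altSum-+ (suc m) f g = begin
  altSum m (λ k → f k ℕ.+ g k) + s * + (f (suc m) ℕ.+ g (suc m))
    ≡⟨ cong₂ _+_ (altSum-+ m f g) (trans (cong (s *_) (pos-+ (f (suc m)) (g (suc m)))) (*-distribˡ-+ s _ _)) ⟩
  (altSum m f + altSum m g) + (s * + f (suc m) + s * + g (suc m))
    ≡⟨ interchange (altSum m f) (altSum m g) _ _ ⟩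
  altSum (suc m) f + altSum (suc m) g ∎
  where s = sign (suc m)

altSum-vanish : ∀ m (f : ℕ → ℕ) → (∀ k → k ≤ m → f k ≡ 0) → altSum m f ≡ 0ℤ
altSum-vanish zero    f f≡0 = cong +_ (f≡0 0 z≤n)
altSum-vanish (suc m) f f≡0 = begin
  altSum m f + sign (suc m) * + f (suc m)
    ≡⟨ cong₂ (λ a b → a + sign (suc m) * + b)
             (altSum-vanish m f (λ k k≤m → f≡0 k (m≤n⇒m≤1+n k≤m))) (f≡0 (suc m) ≤-refl) ⟩
  0ℤ + sign (suc m) * 0ℤ
    ≡⟨ cong (_+_ 0ℤ) (*-zeroʳ (sign (suc m))) ⟩
  0ℤ ∎

altSum-indicator : ∀ {w} m → w ≤ m → altSum m (λ k → 𝟙 (w ≡ᵇ k)) ≡ sign w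
altSum-indicator zero z≤n = refl
altSum-indicator {w} (suc m) w≤1+m with m≤n⇒m<n∨m≡n w≤1+m
... | inj₁ w<1+m@(s≤s w≤m) = begin
  altSum m (λ k → 𝟙 (w ≡ᵇ k)) + sign (suc m) * + 𝟙 (w ≡ᵇ suc m)
    ≡⟨ cong₂ (λ a b → a + sign (suc m) * + 𝟙 b) (altSum-indicator m w≤m) (dec-false (w ≟ suc m) (<⇒≢ w<1+m)) ⟩
  sign w + sign (suc m) * 0ℤ
    ≡⟨ cong (_+_ (sign w)) (*-zeroʳ (sign (suc m))) ⟩
  sign w + 0ℤ
    ≡⟨ +-identityʳ (sign w) ⟩
  sign w ∎
... | inj₂ refl = begin
  altSum m (λ k → 𝟙 (suc m ≡ᵇ k)) + sign (suc m) * + 𝟙 (suc m ≡ᵇ suc m)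
    ≡⟨ cong₂ (λ a b → a + sign (suc m) * + 𝟙 b) earlier-terms-vanish (dec-true (suc m ≟ suc m) refl) ⟩
  0ℤ + sign (suc m) * 1ℤ
    ≡⟨ +-identityˡ _ ⟩
  sign (suc m) * 1ℤ
    ≡⟨ *-identityʳ (sign (suc m)) ⟩
  sign (suc m) ∎
  where
  earlier-terms-vanish : altSum m (λ k → 𝟙 (suc m ≡ᵇ k)) ≡ 0ℤ
  earlier-terms-vanish =
    altSum-vanish m _ (λ k k≤m → cong 𝟙 (dec-false (suc m ≟ k) (>⇒≢ (s≤s k≤m))))

altSum-𝟙-∧ : ∀ b {w} m → w ≤ m → altSum m (λ k → 𝟙 (b ∧ (w ≡ᵇ k))) ≡ signIf b w
altSum-𝟙-∧ true  m w≤m = altSum-indicator m w≤m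
altSum-𝟙-∧ false m _   = altSum-vanish m _ (λ _ _ → refl)

module _ {X : Set} where

  sumMap : (X → ℤ) → List X → ℤ
  sumMap h []       = 0ℤ
  sumMap h (x ∷ xs) = h x + sumMap h xs

  sumMap-cong : ∀ {g h : X → ℤ} → (∀ x → g x ≡ h x) → ∀ xs → sumMap g xs ≡ sumMap h xs
  sumMap-cong g≗h []       = refl
  sumMap-cong g≗h (x ∷ xs) = cong₂ _+_ (g≗h x) (sumMap-cong g≗h xs)

  sumMap-++ : ∀ (h : X → ℤ) xs ys → sumMap h (xs ++ ys) ≡ sumMap h xs + sumMap h ys
  sumMap-++ h []       ys = sym (+-identityˡ (sumMap h ys))
  sumMap-++ h (x ∷ xs) ys = trans (cong (_+_ (h x)) (sumMap-++ h xs ys)) (sym (+-assoc (h x) _ _))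

  length-filterᵇ-∷ : ∀ (p : X → Bool) x xs → length (filterᵇ p (x ∷ xs)) ≡ 𝟙 (p x) ℕ.+ length (filterᵇ p xs)
  length-filterᵇ-∷ p x xs with p x
  ... | true  = refl
  ... | false = refl

  altSum-length-filterᵇ : ∀ m (q : ℕ → X → Bool) xs →
    altSum m (λ k → length (filterᵇ (q k) xs)) ≡ sumMap (λ x → altSum m (λ k → 𝟙 (q k x))) xs
  altSum-length-filterᵇ m q []       = altSum-vanish m _ (λ _ _ → refl)
  altSum-length-filterᵇ m q (x ∷ xs) = begin
    altSum m (λ k → length (filterᵇ (q k) (x ∷ xs)))
      ≡⟨ altSum-cong m (λ k → length-filterᵇ-∷ (q k) x xs) ⟩
    altSum m (λ k → 𝟙 (q k x) ℕ.+ length (filterᵇ (q k) xs))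
      ≡⟨ altSum-+ m _ _ ⟩
    altSum m (λ k → 𝟙 (q k x)) + altSum m (λ k → length (filterᵇ (q k) xs))
      ≡⟨ cong (_+_ (altSum m (λ k → 𝟙 (q k x)))) (altSum-length-filterᵇ m q xs) ⟩
    sumMap (λ x → altSum m (λ k → 𝟙 (q k x))) (x ∷ xs) ∎

sumMap-map : ∀ {X Y : Set} (h : Y → ℤ) (f : X → Y) xs → sumMap h (map f xs) ≡ sumMap (λ x → h (f x)) xs
sumMap-map h f []       = refl
sumMap-map h f (x ∷ xs) = cong (_+_ (h (f x))) (sumMap-map h f xs)

sumSubsets : ∀ {n} → (Subset n → ℤ) → ℤ
sumSubsets {zero}  h = h []
sumSubsets {suc n} h = sumSubsets (λ C → h (outside ∷ C)) + sumSubsets (λ C → h (inside ∷ C))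

sumSubsets-cong : ∀ {n} {g h : Subset n → ℤ} → (∀ C → g C ≡ h C) → sumSubsets g ≡ sumSubsets h
sumSubsets-cong {zero}  g≗h = g≗h []
sumSubsets-cong {suc n} g≗h =
  cong₂ _+_ (sumSubsets-cong (λ C → g≗h (outside ∷ C))) (sumSubsets-cong (λ C → g≗h (inside ∷ C)))

sumSubsets-0 : ∀ {n} → sumSubsets {n} (λ _ → 0ℤ) ≡ 0ℤ
sumSubsets-0 {zero}  = refl
sumSubsets-0 {suc n} = cong₂ _+_ (sumSubsets-0 {n}) (sumSubsets-0 {n})

sumSubsets-+ : ∀ {n} (g h : Subset n → ℤ) → sumSubsets (λ C → g C + h C) ≡ sumSubsets g + sumSubsets h
sumSubsets-+ {zero}  g h = refl
sumSubsets-+ {suc n} g h = trans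
  (cong₂ _+_ (sumSubsets-+ (λ C → g (outside ∷ C)) (λ C → h (outside ∷ C)))
             (sumSubsets-+ (λ C → g (inside ∷ C)) (λ C → h (inside ∷ C))))
  (interchange (sumSubsets (λ C → g (outside ∷ C))) (sumSubsets (λ C → h (outside ∷ C)))
               (sumSubsets (λ C → g (inside ∷ C))) (sumSubsets (λ C → h (inside ∷ C))))

sumSubsets-neg : ∀ {n} (h : Subset n → ℤ) → sumSubsets (λ C → - h C) ≡ - sumSubsets h
sumSubsets-neg {zero}  h = refl
sumSubsets-neg {suc n} h = trans
  (cong₂ _+_ (sumSubsets-neg (λ C → h (outside ∷ C))) (sumSubsets-neg (λ C → h (inside ∷ C))))
  (sym (neg-distrib-+ (sumSubsets (λ C → h (outside ∷ C))) (sumSubsets (λ C → h (inside ∷ C)))))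

sumSubsets≡sumMap : ∀ {n} (h : Subset n → ℤ) → sumSubsets h ≡ sumMap h (allSubsets n)
sumSubsets≡sumMap {zero}  h = sym (+-identityʳ (h []))
sumSubsets≡sumMap {suc n} h = sym (begin
  sumMap h (map (outside ∷_) (allSubsets n) ++ map (inside ∷_) (allSubsets n))
    ≡⟨ sumMap-++ h (map (outside ∷_) (allSubsets n)) (map (inside ∷_) (allSubsets n)) ⟩
  sumMap h (map (outside ∷_) (allSubsets n)) + sumMap h (map (inside ∷_) (allSubsets n))
    ≡⟨ cong₂ _+_ (sumMap-map h _ (allSubsets n)) (sumMap-map h _ (allSubsets n)) ⟩
  sumMap (λ C → h (outside ∷ C)) (allSubsets n) + sumMap (λ C → h (inside ∷ C)) (allSubsets n)
    ≡⟨ cong₂ _+_ (sumSubsets≡sumMap (λ C → h (outside ∷ C))) (sumSubsets≡sumMap (λ C → h (inside ∷ C))) ⟨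
  sumSubsets h ∎)

pairAt : ∀ {n} → Fin n → (Subset n → ℤ) → Subset n → ℤ
pairAt i h C = if lookup C i then 0ℤ else h C + h (C [ i ]≔ inside)

sumSubsets-pairAt : ∀ {n} (i : Fin n) (h : Subset n → ℤ) → sumSubsets h ≡ sumSubsets (pairAt i h)
sumSubsets-pairAt {suc n} zero h = sym (begin
  sumSubsets paired + sumSubsets {n} (λ _ → 0ℤ)  ≡⟨ cong (_+_ (sumSubsets paired)) (sumSubsets-0 {n}) ⟩
  sumSubsets paired + 0ℤ                         ≡⟨ +-identityʳ (sumSubsets paired) ⟩
  sumSubsets paired                              ≡⟨ sumSubsets-+ (λ C → h (outside ∷ C)) (λ C → h (inside ∷ C)) ⟩
  sumSubsets h                                   ∎)
  where
  paired : Subset n → ℤ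
  paired C = h (outside ∷ C) + h (inside ∷ C)
sumSubsets-pairAt {suc n} (suc i) h =
  cong₂ _+_ (sumSubsets-pairAt i (λ C → h (outside ∷ C))) (sumSubsets-pairAt i (λ C → h (inside ∷ C)))

∈-allSubsets : ∀ {n} (D : Subset n) → D List.∈ allSubsets n
∈-allSubsets []            = Any.here refl
∈-allSubsets (outside ∷ D) = ∈-++⁺ˡ (∈-map⁺ (outside ∷_) (∈-allSubsets D))
∈-allSubsets {suc n} (inside ∷ D) =
  ∈-++⁺ʳ (map (outside ∷_) (allSubsets n)) (∈-map⁺ (inside ∷_) (∈-allSubsets D))

subsetSign : ∀ {n} → Subset n → Subset n → ℤ
subsetSign B C = signIf (does (C ⊆? B)) ∣ B ─ C ∣

binomialSum : ∀ {n} → Subset n → ℤ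
binomialSum B = sumSubsets (subsetSign B)

binomialSum-nonempty : ∀ {n} {B : Subset n} → Nonempty B → binomialSum B ≡ 0ℤ
binomialSum-nonempty {suc n} {inside ∷ B} _ = begin
  sumSubsets (λ C → subsetSign (inside ∷ B) (outside ∷ C)) + binomialSum B
    ≡⟨ cong (_+ binomialSum B) (sumSubsets-cong (λ C → signIf-suc (does (C ⊆? B)) ∣ B ─ C ∣)) ⟩
  sumSubsets (λ C → - subsetSign B C) + binomialSum B
    ≡⟨ cong (_+ binomialSum B) (sumSubsets-neg (subsetSign B)) ⟩
  - binomialSum B + binomialSum B
    ≡⟨ +-inverseˡ (binomialSum B) ⟩
  0ℤ ∎
binomialSum-nonempty {suc n} {outside ∷ B} (suc x , there x∈B) =
  cong₂ _+_ (binomialSum-nonempty (x , x∈B)) (sumSubsets-0 {n})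

∣p[i]≔outside∣<∣p∣ : ∀ {n} (i : Fin n) p → i ∈ p → ∣ p [ i ]≔ outside ∣ < ∣ p ∣
∣p[i]≔outside∣<∣p∣ zero    (inside ∷ p)  here        = n<1+n ∣ p ∣
∣p[i]≔outside∣<∣p∣ (suc i) (outside ∷ p) (there i∈p) = ∣p[i]≔outside∣<∣p∣ i p i∈p
∣p[i]≔outside∣<∣p∣ (suc i) (inside ∷ p)  (there i∈p) = s≤s (∣p[i]≔outside∣<∣p∣ i p i∈p)

p[i]≔outside⊆p : ∀ {n} (i : Fin n) p → p [ i ]≔ outside ⊆ p
p[i]≔outside⊆p zero    (x ∷ p) (there y∈p) = there y∈p
p[i]≔outside⊆p (suc i) (x ∷ p) here        = here
p[i]≔outside⊆p (suc i) (x ∷ p) (there y∈p) = there (p[i]≔outside⊆p i p y∈p)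

q⊆p⇒q⊆p[i]≔outside : ∀ {n} (i : Fin n) {q p} → lookup q i ≡ outside → q ⊆ p → q ⊆ p [ i ]≔ outside
q⊆p⇒q⊆p[i]≔outside zero    {outside ∷ q} {x ∷ p}       refl q⊆p = out⊆ (drop-∷-⊆ q⊆p)
q⊆p⇒q⊆p[i]≔outside (suc i) {outside ∷ q} {x ∷ p}       i∉q  q⊆p =
  out⊆ (q⊆p⇒q⊆p[i]≔outside i i∉q (drop-∷-⊆ q⊆p))
q⊆p⇒q⊆p[i]≔outside (suc i) {inside ∷ q}  {inside ∷ p}  i∉q  q⊆p =
  in⊆in (q⊆p⇒q⊆p[i]≔outside i i∉q (drop-∷-⊆ q⊆p))
q⊆p⇒q⊆p[i]≔outside (suc i) {inside ∷ q}  {outside ∷ p} i∉q  q⊆p = contradiction (q⊆p here) λ ()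

i∈p⇒⁅i⁆⊆p : ∀ {n} {i : Fin n} {p} → i ∈ p → ⁅ i ⁆ ⊆ p
i∈p⇒⁅i⁆⊆p {i = i} {p} i∈p x∈⁅i⁆ = subst (_∈ p) (sym (x∈⁅y⁆⇒x≡y i x∈⁅i⁆)) i∈p

does-q⊆?p≡does-q⊆?p[i]≔outside : ∀ {n} (i : Fin n) q p → lookup q i ≡ outside →
  does (q ⊆? p) ≡ does (q ⊆? p [ i ]≔ outside)
does-q⊆?p≡does-q⊆?p[i]≔outside i q p i∉q =
  does-⇔ (mk⇔ (q⊆p⇒q⊆p[i]≔outside i i∉q) (λ q⊆p′ → ⊆-trans q⊆p′ (p[i]≔outside⊆p i p))) (q ⊆? p) (q ⊆? _)

does-q⊆?p[i]≔outside≡false : ∀ {n} (i : Fin n) q p → i ∈ q → does (q ⊆? p [ i ]≔ outside) ≡ false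
does-q⊆?p[i]≔outside≡false i q p i∈q = dec-false (q ⊆? _) λ q⊆p′ →
  contradiction (trans (sym (lookup∘update i p outside)) ([]=⇒lookup (q⊆p′ i∈q))) λ ()

does-q[i]≔inside⊆?p≡does-q⊆?p[i]≔outside : ∀ {n} (i : Fin n) q p → lookup q i ≡ outside → i ∈ p →
  does (q [ i ]≔ inside ⊆? p) ≡ does (q ⊆? p [ i ]≔ outside)
does-q[i]≔inside⊆?p≡does-q⊆?p[i]≔outside zero    (outside ∷ q) (inside ∷ p)  refl here        = refl
does-q[i]≔inside⊆?p≡does-q⊆?p[i]≔outside (suc i) (outside ∷ q) (x ∷ p)       i∉q  (there i∈p) =
  does-q[i]≔inside⊆?p≡does-q⊆?p[i]≔outside i q p i∉q i∈p
does-q[i]≔inside⊆?p≡does-q⊆?p[i]≔outside (suc i) (inside ∷ q)  (outside ∷ p) i∉q  (there i∈p) = refl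
does-q[i]≔inside⊆?p≡does-q⊆?p[i]≔outside (suc i) (inside ∷ q)  (inside ∷ p)  i∉q  (there i∈p) =
  does-q[i]≔inside⊆?p≡does-q⊆?p[i]≔outside i q p i∉q i∈p

∣p─q∣≡1+∣p[i]≔outside─q∣ : ∀ {n} (i : Fin n) p q → i ∈ p → lookup q i ≡ outside →
  ∣ p ─ q ∣ ≡ suc ∣ p [ i ]≔ outside ─ q ∣
∣p─q∣≡1+∣p[i]≔outside─q∣ zero    (inside ∷ p)  (outside ∷ q) here        refl = refl
∣p─q∣≡1+∣p[i]≔outside─q∣ (suc i) (x ∷ p)       (inside ∷ q)  (there i∈p) i∉q  =
  ∣p─q∣≡1+∣p[i]≔outside─q∣ i p q i∈p i∉q
∣p─q∣≡1+∣p[i]≔outside─q∣ (suc i) (outside ∷ p) (outside ∷ q) (there i∈p) i∉q  =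
  ∣p─q∣≡1+∣p[i]≔outside─q∣ i p q i∈p i∉q
∣p─q∣≡1+∣p[i]≔outside─q∣ (suc i) (inside ∷ p)  (outside ∷ q) (there i∈p) i∉q  =
  cong suc (∣p─q∣≡1+∣p[i]≔outside─q∣ i p q i∈p i∉q)

p─q[i]≔inside≡p[i]≔outside─q : ∀ {n} (i : Fin n) p q → p ─ (q [ i ]≔ inside) ≡ p [ i ]≔ outside ─ q
p─q[i]≔inside≡p[i]≔outside─q zero    (x ∷ p) (outside ∷ q) = refl
p─q[i]≔inside≡p[i]≔outside─q zero    (x ∷ p) (inside ∷ q)  = refl
p─q[i]≔inside≡p[i]≔outside─q (suc i) (x ∷ p) (outside ∷ q) =
  cong (x ∷_) (p─q[i]≔inside≡p[i]≔outside─q i p q)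
p─q[i]≔inside≡p[i]≔outside─q (suc i) (x ∷ p) (inside ∷ q)  =
  cong (outside ∷_) (p─q[i]≔inside≡p[i]≔outside─q i p q)

T-not-∧-∨ : ∀ {A B C : Set} (A? : Dec A) (B? : Dec B) (C? : Dec C) →
  T (not (does A? ∧ does B?) ∨ does C?) ⇔ (A → B → C)
T-not-∧-∨ (yes _) (yes _) (yes c) = mk⇔ (λ _ _ _ → c) (λ _ → _)
T-not-∧-∨ (yes a) (yes b) (no ¬c) = mk⇔ (λ ()) (λ a→b→c → ¬c (a→b→c a b))
T-not-∧-∨ (yes _) (no ¬b) _       = mk⇔ (λ _ _ b → contradiction b ¬b) (λ _ → _)
T-not-∧-∨ (no ¬a) _       _       = mk⇔ (λ _ a → contradiction a ¬a) (λ _ → _)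

module _ {n} {𝓕 : Pred (Subset n) 0ℓ} (𝓕? : Decidable 𝓕) where

  T-intervalInᵇ : ∀ C A → T (intervalInᵇ 𝓕? C A) ⇔ IntervalIn 𝓕 C A
  T-intervalInᵇ C A = mk⇔
    (λ t D → Equivalence.to (atD D) (All.lookup (all⁺ _ (allSubsets n) t) (∈-allSubsets D)))
    (λ iv → all⁻ _ {allSubsets n} (All.tabulate (λ {D} _ → Equivalence.from (atD D) (iv D))))
    where
    atD : ∀ D → T (not (does (C ⊆? D) ∧ does (D ⊆? A)) ∨ does (𝓕? D)) ⇔ (C ⊆ D → D ⊆ A → 𝓕 D)
    atD D = T-not-∧-∨ (C ⊆? D) (D ⊆? A) (𝓕? D)

  intervalInᵇ-true : ∀ {C A} → IntervalIn 𝓕 C A → intervalInᵇ 𝓕? C A ≡ true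
  intervalInᵇ-true {C} {A} iv = Equivalence.to T-≡ (Equivalence.from (T-intervalInᵇ C A) iv)

  intervalInᵇ-false : ∀ {C A} → ¬ IntervalIn 𝓕 C A → intervalInᵇ 𝓕? C A ≡ false
  intervalInᵇ-false {C} {A} ¬iv = dec-false (T? _) (λ t → ¬iv (Equivalence.to (T-intervalInᵇ C A) t))

  intervalInᵇ-cong : ∀ {C A C′ A′} → IntervalIn 𝓕 C A ⇔ IntervalIn 𝓕 C′ A′ →
    intervalInᵇ 𝓕? C A ≡ intervalInᵇ 𝓕? C′ A′
  intervalInᵇ-cong {C} {A} {C′} {A′} iv⇔iv′ =
    does-⇔ (⇔.trans (T-intervalInᵇ C A) (⇔.trans iv⇔iv′ (⇔.sym (T-intervalInᵇ C′ A′)))) (T? _) (T? _)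

  intervalSign : Subset n → Subset n → ℤ
  intervalSign A C = signIf (does (C ⊆? A) ∧ intervalInᵇ 𝓕? C A) ∣ A ─ C ∣

  signedCount : Subset n → ℤ
  signedCount A = sumSubsets (intervalSign A)

  altSum-countC : ∀ A → altSum ∣ A ∣ (countC 𝓕? A) ≡ signedCount A
  altSum-countC A = begin
    altSum ∣ A ∣ (countC 𝓕? A)                                ≡⟨ altSum-length-filterᵇ ∣ A ∣ q (allSubsets n) ⟩
    sumMap (λ C → altSum ∣ A ∣ (λ k → 𝟙 (q k C))) (allSubsets n) ≡⟨ sumMap-cong weigh (allSubsets n) ⟩
    sumMap (intervalSign A) (allSubsets n)                     ≡⟨ sumSubsets≡sumMap (intervalSign A) ⟨
    signedCount A                                              ∎
    where
    q : ℕ → Subset n → Bool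
    q k C = does (C ⊆? A) ∧ intervalInᵇ 𝓕? C A ∧ (∣ A ─ C ∣ ≡ᵇ k)
    weigh : ∀ C → altSum ∣ A ∣ (λ k → 𝟙 (q k C)) ≡ intervalSign A C
    weigh C = trans
      (altSum-cong ∣ A ∣ (λ k → cong 𝟙 (sym (∧-assoc (does (C ⊆? A)) (intervalInᵇ 𝓕? C A) (∣ A ─ C ∣ ≡ᵇ k)))))
      (altSum-𝟙-∧ (does (C ⊆? A) ∧ intervalInᵇ 𝓕? C A) ∣ A ∣ (∣p─q∣≤∣p∣ A C))

  signedCount-∉ : ∀ {A} → ¬ 𝓕 A → signedCount A ≡ 0ℤ
  signedCount-∉ {A} A∉𝓕 = trans (sumSubsets-cong vanish) (sumSubsets-0 {n})
    where
    vanish : ∀ C → intervalSign A C ≡ 0ℤ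
    vanish C with C ⊆? A
    ... | no  _   = refl
    ... | yes C⊆A = cong (λ b → signIf b ∣ A ─ C ∣) (intervalInᵇ-false (λ iv → A∉𝓕 (iv A C⊆A ⊆-refl)))

  signedCount-full : ∀ {A} → IntervalIn 𝓕 ⊥ A → signedCount A ≡ binomialSum A
  signedCount-full {A} full = sumSubsets-cong agree
    where
    agree : ∀ C → intervalSign A C ≡ subsetSign A C
    agree C with C ⊆? A
    ... | no  _ = refl
    ... | yes _ = cong (λ b → signIf b ∣ A ─ C ∣) (intervalInᵇ-true {C} (λ D _ → full D (⊆-min D)))

  module Peel {A : Subset n} {i : Fin n} (i∈A : i ∈ A) (root : IntervalIn 𝓕 ⁅ i ⁆ A) where

    A′ : Subset n
    A′ = A [ i ]≔ outside

    intervalIn-peel : ∀ {C} → IntervalIn 𝓕 C A ⇔ IntervalIn 𝓕 C A′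
    intervalIn-peel {C} = mk⇔ (λ iv D C⊆D D⊆A′ → iv D C⊆D (⊆-trans D⊆A′ (p[i]≔outside⊆p i A))) from
      where
      from : IntervalIn 𝓕 C A′ → IntervalIn 𝓕 C A
      from iv′ D C⊆D D⊆A with lookup D i in eq
      ... | inside  = root D (i∈p⇒⁅i⁆⊆p (lookup⇒[]= i D eq)) D⊆A
      ... | outside = iv′ D C⊆D (q⊆p⇒q⊆p[i]≔outside i eq D⊆A)

    intervalIn-[]≔inside : ∀ C → IntervalIn 𝓕 (C [ i ]≔ inside) A
    intervalIn-[]≔inside C D C′⊆D = root D (i∈p⇒⁅i⁆⊆p (C′⊆D ([]≔-updates C i)))

    intervalSign-peel : ∀ C → lookup C i ≡ outside → intervalSign A C ≡ - intervalSign A′ C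
    intervalSign-peel C i∉C = begin
      signIf (does (C ⊆? A) ∧ intervalInᵇ 𝓕? C A) ∣ A ─ C ∣
        ≡⟨ cong₂ signIf (cong₂ _∧_ (does-q⊆?p≡does-q⊆?p[i]≔outside i C A i∉C)
                                   (intervalInᵇ-cong (intervalIn-peel {C})))
                        (∣p─q∣≡1+∣p[i]≔outside─q∣ i A C i∈A i∉C) ⟩
      signIf (does (C ⊆? A′) ∧ intervalInᵇ 𝓕? C A′) (suc ∣ A′ ─ C ∣)
        ≡⟨ signIf-suc (does (C ⊆? A′) ∧ intervalInᵇ 𝓕? C A′) ∣ A′ ─ C ∣ ⟩
      - intervalSign A′ C ∎

    intervalSign-[]≔inside : ∀ C → lookup C i ≡ outside → intervalSign A (C [ i ]≔ inside) ≡ subsetSign A′ C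
    intervalSign-[]≔inside C i∉C = begin
      signIf (does (C [ i ]≔ inside ⊆? A) ∧ intervalInᵇ 𝓕? (C [ i ]≔ inside) A) ∣ A ─ C [ i ]≔ inside ∣
        ≡⟨ cong₂ signIf (cong₂ _∧_ (does-q[i]≔inside⊆?p≡does-q⊆?p[i]≔outside i C A i∉C i∈A)
                                   (intervalInᵇ-true (intervalIn-[]≔inside C)))
                        (cong ∣_∣ (p─q[i]≔inside≡p[i]≔outside─q i A C)) ⟩
      signIf (does (C ⊆? A′) ∧ true) ∣ A′ ─ C ∣
        ≡⟨ cong (λ b → signIf b ∣ A′ ─ C ∣) (∧-identityʳ _) ⟩
      subsetSign A′ C ∎

    pairAt-intervalSign : ∀ C → pairAt i (intervalSign A) C ≡ subsetSign A′ C - intervalSign A′ C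
    pairAt-intervalSign C with lookup C i in eq
    ... | inside  = sym (cong (λ b → signIf b (∣ A′ ─ C ∣) - signIf (b ∧ intervalInᵇ 𝓕? C A′) (∣ A′ ─ C ∣))
                              (does-q⊆?p[i]≔outside≡false i C A (lookup⇒[]= i C eq)))
    ... | outside = trans (cong₂ _+_ (intervalSign-peel C eq) (intervalSign-[]≔inside C eq))
                          (+-comm (- intervalSign A′ C) (subsetSign A′ C))

    signedCount-peel : signedCount A ≡ binomialSum A′ - signedCount A′
    signedCount-peel = begin
      signedCount A
        ≡⟨ sumSubsets-pairAt i (intervalSign A) ⟩
      sumSubsets (pairAt i (intervalSign A))
        ≡⟨ sumSubsets-cong pairAt-intervalSign ⟩
      sumSubsets (λ C → subsetSign A′ C - intervalSign A′ C)
        ≡⟨ sumSubsets-+ (subsetSign A′) (λ C → - intervalSign A′ C) ⟩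
      binomialSum A′ + sumSubsets (λ C → - intervalSign A′ C)
        ≡⟨ cong (_+_ (binomialSum A′)) (sumSubsets-neg (intervalSign A′)) ⟩
      binomialSum A′ - signedCount A′ ∎

  signedCount≡binomialSum : SimplyRooted 𝓕 → 𝓕 ⊥ → ∀ A → signedCount A ≡ binomialSum A
  signedCount≡binomialSum SR ⊥∈𝓕 A = bounded (suc ∣ A ∣) A (n<1+n ∣ A ∣)
    where
    bounded : ∀ m A → ∣ A ∣ < m → signedCount A ≡ binomialSum A
    bounded (suc m) A (s≤s ∣A∣≤m) with nonempty? A
    ... | no A-empty = subst (λ B → signedCount B ≡ binomialSum B) (sym (Empty-unique A-empty))
                         (signedCount-full (λ D _ D⊆⊥ → subst 𝓕 (⊆-antisym (⊆-min D) D⊆⊥) ⊥∈𝓕))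
    ... | yes A-nonempty with 𝓕? A
    ...   | no A∉𝓕 = trans (signedCount-∉ A∉𝓕) (sym (binomialSum-nonempty A-nonempty))
    ...   | yes A∈𝓕 with SR A A∈𝓕 A-nonempty
    ...     | i , i∈A , root = begin
      signedCount A                   ≡⟨ Peel.signedCount-peel i∈A root ⟩
      binomialSum A′ - signedCount A′ ≡⟨ cong (_-_ (binomialSum A′)) (bounded m A′ ∣A′∣<m) ⟩
      binomialSum A′ - binomialSum A′ ≡⟨ +-inverseʳ (binomialSum A′) ⟩
      0ℤ                              ≡⟨ binomialSum-nonempty A-nonempty ⟨
      binomialSum A                   ∎
      where
      A′ : Subset n
      A′ = A [ i ]≔ outside
      ∣A′∣<m : ∣ A′ ∣ < m
      ∣A′∣<m = <-≤-trans (∣p[i]≔outside∣<∣p∣ i A i∈A) ∣A∣≤m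

lemma2p16 : ∀ (n : ℕ) (𝓕 : Pred (Subset n) 0ℓ) (𝓕? : Decidable 𝓕) →
    SimplyRooted 𝓕 → 𝓕 ⊥ → ∀ (A : Subset n) → 𝓕 A → Nonempty A →
    altSum ∣ A ∣ (countC 𝓕? A) ≡ 0ℤ
lemma2p16 n 𝓕 𝓕? SR ⊥∈𝓕 A _ A-nonempty = begin
  altSum ∣ A ∣ (countC 𝓕? A)  ≡⟨ altSum-countC 𝓕? A ⟩
  signedCount 𝓕? A            ≡⟨ signedCount≡binomialSum 𝓕? SR ⊥∈𝓕 A ⟩
  binomialSum A               ≡⟨ binomialSum-nonempty A-nonempty ⟩
  0ℤ                          ∎
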